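{- Let $(\mathbb{O},\star_O)$ be the $\mathbb{R}$-algebra of octonions. Then $\mathbb{O}^+$ is not associative, i.e. there are subspaces $\mathbb{U},\mathbb{W},\mathbb{Z}$ of $\mathbb{O}$ with $(\mathbb{U}\otimes\mathbb{W})\otimes\mathbb{Z}\neq\mathbb{U}\otimes(\mathbb{W}\otimes\mathbb{Z})$.
   Context: $\mathbb{O}$ is the 8-dimensional real vector space with basis $e_0,\dots,e_7$, and $\star_O$ is the bilinear product given on basis elements by the following rows (row $e_a$ lists $e_a\star_O e_b$ for $b=0,\dots,7$): $e_0$: $e_0,e_1,e_2,e_3,e_4,e_5,e_6,e_7$; $e_1$: $e_1,-e_0,e_3,-e_2,e_5,-e_4,-e_7,e_6$; $e_2$: $e_2,-e_3,-e_0,e_1,e_6,e_7,-e_4,-e_5$; $e_3$: $e_3,e_2,-e_1,-e_0,e_7,-e_6,e_5,-e_4$; $e_4$: $e_4,-e_5,-e_6,-e_7,-e_0,e_1,e_2,e_3$; $e_5$: $e_5,e_4,-e_7,e_6,-e_1,-e_0,-e_3,e_2$; $e_6$: $e_6,e_7,e_4,-e_5,-e_2,e_3,-e_0,-e_1$; $e_7$: $e_7,-e_6,e_5,e_4,-e_3,-e_2,e_1,-e_0$. For a $\mathbb{K}$-algebra $(\mathbb{V},\star)$, $\mathbb{V}^+$ is the set of subspaces of $\mathbb{V}$ with $\mathbb{U}\otimes\mathbb{W}:=$ the linear span of $\{u\star w\mid u\in\mathbb{U},w\in\mathbb{W}\}$. -}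

module Defs where

open import Level using (Level; _⊔_) renaming (suc to lsuc)
open import Algebra.Bundles using (CommutativeRing)
open import Relation.Binary.Core using (Rel)
open import Relation.Binary.Structures using (IsTotalOrder)
open import Relation.Nullary using (¬_)
open import Data.Product using (Σ; ∃; ∃-syntax; _×_; _,_; proj₁; proj₂)
open import Data.Bool using (Bool; true; false; if_then_else_)
open import Data.Fin using (Fin; zero; suc; _≟_)
open import Data.Vec using (Vec; []; _∷_; lookup)
open import Data.List using (List; []; _∷_)
open import Data.List.Relation.Unary.All using (All)
open import Relation.Nullary.Decidable using (does)

-- The real numbers. agda-stdlib has no real numbers, so we axiomatise
-- them: a complete ordered field (commutative ring, nontrivial,
-- every nonzero element invertible, compatible total order, and the
-- least-upper-bound property).

record RealNumbers (c ℓ₁ ℓ₂ : Level) : Set (lsuc (c ⊔ ℓ₁ ⊔ ℓ₂)) where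
  field
    commutativeRing : CommutativeRing c ℓ₁
  open CommutativeRing commutativeRing public
  field
    _≤_          : Rel Carrier ℓ₂
    isTotalOrder : IsTotalOrder _≈_ _≤_
    0≉1          : ¬ (0# ≈ 1#)
    inverse      : ∀ x → ¬ (x ≈ 0#) → ∃[ y ] (x * y ≈ 1#)
    +-mono-≤     : ∀ {x y} z → x ≤ y → (x + z) ≤ (y + z)
    *-nonneg     : ∀ {x y} → 0# ≤ x → 0# ≤ y → 0# ≤ (x * y)
    lub          : (P : Carrier → Set (c ⊔ ℓ₂)) →
                   ∃[ x ] P x →
                   ∃[ b ] (∀ x → P x → x ≤ b) →
                   ∃[ s ] ((∀ x → P x → x ≤ s) ×
                           (∀ b → (∀ x → P x → x ≤ b) → s ≤ b))

-- Multiplication table of the octonions: e_a ⋆ e_b = ± e_k,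
-- encoded as (sign , k) with sign true meaning +.

private
  pattern f0 = zero
  pattern f1 = suc zero
  pattern f2 = suc (suc zero)
  pattern f3 = suc (suc (suc zero))
  pattern f4 = suc (suc (suc (suc zero)))
  pattern f5 = suc (suc (suc (suc (suc zero))))
  pattern f6 = suc (suc (suc (suc (suc (suc zero)))))
  pattern f7 = suc (suc (suc (suc (suc (suc (suc zero))))))

  p m : Fin 8 → Bool × Fin 8
  p k = true , k
  m k = false , k

octTable : Vec (Vec (Bool × Fin 8) 8) 8
octTable =
    (p f0 ∷ p f1 ∷ p f2 ∷ p f3 ∷ p f4 ∷ p f5 ∷ p f6 ∷ p f7 ∷ [])
  ∷ (p f1 ∷ m f0 ∷ p f3 ∷ m f2 ∷ p f5 ∷ m f4 ∷ m f7 ∷ p f6 ∷ [])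
  ∷ (p f2 ∷ m f3 ∷ m f0 ∷ p f1 ∷ p f6 ∷ p f7 ∷ m f4 ∷ m f5 ∷ [])
  ∷ (p f3 ∷ p f2 ∷ m f1 ∷ m f0 ∷ p f7 ∷ m f6 ∷ p f5 ∷ m f4 ∷ [])
  ∷ (p f4 ∷ m f5 ∷ m f6 ∷ m f7 ∷ m f0 ∷ p f1 ∷ p f2 ∷ p f3 ∷ [])
  ∷ (p f5 ∷ p f4 ∷ m f7 ∷ p f6 ∷ m f1 ∷ m f0 ∷ m f3 ∷ p f2 ∷ [])
  ∷ (p f6 ∷ p f7 ∷ p f4 ∷ m f5 ∷ m f2 ∷ p f3 ∷ m f0 ∷ m f1 ∷ [])
  ∷ (p f7 ∷ m f6 ∷ p f5 ∷ p f4 ∷ m f3 ∷ m f2 ∷ p f1 ∷ m f0 ∷ [])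
  ∷ []

octSign : Fin 8 → Fin 8 → Bool
octSign a b = proj₁ (lookup (lookup octTable a) b)

octIndex : Fin 8 → Fin 8 → Fin 8
octIndex a b = proj₂ (lookup (lookup octTable a) b)

module Octonions {c ℓ₁ ℓ₂ : Level} (ℝ : RealNumbers c ℓ₁ ℓ₂) where
  open RealNumbers ℝ

  -- 𝕆 = ℝ⁸, coordinates w.r.t. the basis e_0,…,e_7
  𝕆 : Set c
  𝕆 = Fin 8 → Carrier

  infix 4 _≈ᵒ_
  _≈ᵒ_ : 𝕆 → 𝕆 → Set ℓ₁
  x ≈ᵒ y = ∀ i → x i ≈ y i

  0ᵒ : 𝕆
  0ᵒ _ = 0#

  infixl 6 _+ᵒ_
  _+ᵒ_ : 𝕆 → 𝕆 → 𝕆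
  (x +ᵒ y) i = x i + y i

  infixr 7 _•_
  _•_ : Carrier → 𝕆 → 𝕆
  (r • x) i = r * x i

  ∑₈ : (Fin 8 → Carrier) → Carrier
  ∑₈ f = f f0 + (f f1 + (f f2 + (f f3 + (f f4 + (f f5 + (f f6 + f f7))))))

  infixl 7 _⋆_
  _⋆_ : 𝕆 → 𝕆 → 𝕆
  (x ⋆ y) k = ∑₈ λ a → ∑₈ λ b →
    if does (octIndex a b ≟ k)
    then (if octSign a b then x a * y b else - (x a * y b))
    else 0#

  record Subspace : Set (lsuc (c ⊔ ℓ₁)) where
    field
      _∈S    : 𝕆 → Set (c ⊔ ℓ₁)
      resp   : ∀ {x y} → x ≈ᵒ y → x ∈S → y ∈S
      0∈     : 0ᵒ ∈S
      +-closed : ∀ {x y} → x ∈S → y ∈S → (x +ᵒ y) ∈S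
      •-closed : ∀ r {x} → x ∈S → (r • x) ∈S
  open Subspace public

  lincomb : List (Carrier × 𝕆) → 𝕆
  lincomb []             = 0ᵒ
  lincomb ((r , v) ∷ xs) = r • v +ᵒ lincomb xs

  Span : (𝕆 → Set (c ⊔ ℓ₁)) → 𝕆 → Set (c ⊔ ℓ₁)
  Span S v = ∃[ xs ] (All (λ rv → S (proj₂ rv)) xs × v ≈ᵒ lincomb xs)

  Products : (𝕆 → Set (c ⊔ ℓ₁)) → (𝕆 → Set (c ⊔ ℓ₁)) → 𝕆 → Set (c ⊔ ℓ₁)
  Products U W x = ∃[ u ] ∃[ w ] (U u × W w × x ≈ᵒ (u ⋆ w))

  infixl 7 _⊗_
  _⊗_ : (𝕆 → Set (c ⊔ ℓ₁)) → (𝕆 → Set (c ⊔ ℓ₁)) → 𝕆 → Set (c ⊔ ℓ₁)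
  U ⊗ W = Span (Products U W)

  _≐_ : (𝕆 → Set (c ⊔ ℓ₁)) → (𝕆 → Set (c ⊔ ℓ₁)) → Set (c ⊔ ℓ₁)
  A ≐ B = ∀ v → (A v → B v) × (B v → A v)

-- Take for U, W, Z the lines spanned by x = e₁ + e₆, y = e₃ + e₄ and z = e₄. The product of two
-- lines lies in the line spanned by the product of their generators, so (U ⊗ W) ⊗ Z contains
-- (x ⋆ y) ⋆ z while U ⊗ (W ⊗ Z) lies on the line through x ⋆ (y ⋆ z). Now
-- (x ⋆ y) ⋆ z = (−2e₂) ⋆ e₄ = −2e₆, whereas x ⋆ (y ⋆ z) = x ⋆ (e₇ − e₀) = −2e₁ has no e₆-component,
-- and 2 ≠ 0 in an ordered field. The relevant coordinates of both products are computed by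
-- evaluating them as closed ring expressions in ℕ.
module Submission where

open import Defs
open import Level using (Level; _⊔_)
open import Algebra.Bundles using (CommutativeRing)
import Algebra.Properties.Ring as RingProperties
import Algebra.Properties.Semiring.Mult as SemiringMultiplication
open import Data.Bool using (Bool; true; false; if_then_else_)
open import Data.Fin using (Fin; _≟_; #_)
open import Data.List using ([]; _∷_)
open import Data.List.Relation.Unary.All using (All; []; _∷_)
open import Data.Maybe using (nothing)
open import Data.Nat as ℕ using (ℕ)
open import Data.Product using (∃-syntax; _×_; _,_; proj₁; proj₂)
open import Data.Sum using (inj₁; inj₂)
open import Data.Vec using ([]; _∷_; lookup)
open import Function using (_∘_)
open import Relation.Binary.Structures using (IsTotalOrder)
open import Relation.Nullary using (¬_)
open import Relation.Nullary.Decidable using (does)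
open import Relation.Unary using (Pred; _⊆′_)
open import Tactic.RingSolver using (solve-∀)
open import Tactic.RingSolver.Core.AlmostCommutativeRing using (AlmostCommutativeRing; fromCommutativeRing)

data Expr : Set where
  0ₑ 1ₑ     : Expr
  _+ₑ_ _*ₑ_ : Expr → Expr → Expr
  -ₑ_       : Expr → Expr

-- The value of an expression, computed in ℕ as a formal difference (positive part , negative part).
difference : Expr → ℕ × ℕ
difference 0ₑ         = 0 , 0
difference 1ₑ         = 1 , 0
difference (t +ₑ u)   with difference t | difference u
... | p , n | p′ , n′ = p ℕ.+ p′ , n ℕ.+ n′
difference (t *ₑ u)   with difference t | difference u
... | p , n | p′ , n′ = p ℕ.* p′ ℕ.+ n ℕ.* n′ , p ℕ.* n′ ℕ.+ n ℕ.* p′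
difference (-ₑ t)     with difference t
... | p , n = n , p

module CommutativeRingIdentities {c ℓ} (R : CommutativeRing c ℓ) where
  almostCommutativeRing : AlmostCommutativeRing c ℓ
  almostCommutativeRing = fromCommutativeRing R (λ _ → nothing)

  open AlmostCommutativeRing almostCommutativeRing

  product-of-differences : ∀ x y m n →
    x * y + ((x + m) * n + m * (y + n)) ≈ (x + m) * (y + n) + m * n
  product-of-differences = solve-∀ almostCommutativeRing

  *-distribˡ-+₈ : ∀ r a b c d e f g h →
    r * a + (r * b + (r * c + (r * d + (r * e + (r * f + (r * g + r * h)))))) ≈
    r * (a + (b + (c + (d + (e + (f + (g + h)))))))
  *-distribˡ-+₈ = solve-∀ almostCommutativeRing

module Evaluation {c ℓ} (R : CommutativeRing c ℓ) where
  open CommutativeRing R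
  open CommutativeRingIdentities R using (product-of-differences)
  private module Mult = SemiringMultiplication semiring
  open import Algebra.Properties.CommutativeSemigroup +-commutativeSemigroup using (interchange)
  open import Relation.Binary.Reasoning.Setoid setoid

  ⟦_⟧ : Expr → Carrier
  ⟦ 0ₑ ⟧     = 0#
  ⟦ 1ₑ ⟧     = 1#
  ⟦ t +ₑ u ⟧ = ⟦ t ⟧ + ⟦ u ⟧
  ⟦ t *ₑ u ⟧ = ⟦ t ⟧ * ⟦ u ⟧
  ⟦ -ₑ t ⟧   = - ⟦ t ⟧

  ⌜_⌝ : ℕ → Carrier
  ⌜ n ⌝ = n Mult.× 1#

  ⌜+⌝ : ∀ m n → ⌜ m ℕ.+ n ⌝ ≈ ⌜ m ⌝ + ⌜ n ⌝
  ⌜+⌝ = Mult.×-homo-+ 1#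

  ⌜*⌝ : ∀ m n → ⌜ m ℕ.* n ⌝ ≈ ⌜ m ⌝ * ⌜ n ⌝
  ⌜*⌝ = Mult.×1-homo-*

  ⟦⟧-difference : ∀ t → let (p , n) = difference t in ⟦ t ⟧ + ⌜ n ⌝ ≈ ⌜ p ⌝
  ⟦⟧-difference 0ₑ = +-identityˡ 0#
  ⟦⟧-difference 1ₑ = refl
  ⟦⟧-difference (t +ₑ u) with difference t | ⟦⟧-difference t | difference u | ⟦⟧-difference u
  ... | p , n | t≈ | p′ , n′ | u≈ = begin
    ⟦ t ⟧ + ⟦ u ⟧ + ⌜ n ℕ.+ n′ ⌝       ≈⟨ +-congˡ (⌜+⌝ n n′) ⟩
    ⟦ t ⟧ + ⟦ u ⟧ + (⌜ n ⌝ + ⌜ n′ ⌝)   ≈⟨ interchange ⟦ t ⟧ ⟦ u ⟧ ⌜ n ⌝ ⌜ n′ ⌝ ⟩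
    ⟦ t ⟧ + ⌜ n ⌝ + (⟦ u ⟧ + ⌜ n′ ⌝)   ≈⟨ +-cong t≈ u≈ ⟩
    ⌜ p ⌝ + ⌜ p′ ⌝                     ≈⟨ ⌜+⌝ p p′ ⟨
    ⌜ p ℕ.+ p′ ⌝                       ∎
  ⟦⟧-difference (t *ₑ u) with difference t | ⟦⟧-difference t | difference u | ⟦⟧-difference u
  ... | p , n | t≈ | p′ , n′ | u≈ = begin
    ⟦ t ⟧ * ⟦ u ⟧ + ⌜ p ℕ.* n′ ℕ.+ n ℕ.* p′ ⌝                 ≈⟨ +-congˡ (⌜+⌝ (p ℕ.* n′) (n ℕ.* p′)) ⟩
    ⟦ t ⟧ * ⟦ u ⟧ + (⌜ p ℕ.* n′ ⌝ + ⌜ n ℕ.* p′ ⌝)             ≈⟨ +-congˡ (+-cong (⌜*⌝ p n′) (⌜*⌝ n p′)) ⟩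
    ⟦ t ⟧ * ⟦ u ⟧ + (⌜ p ⌝ * ⌜ n′ ⌝ + ⌜ n ⌝ * ⌜ p′ ⌝)         ≈⟨ +-congˡ (+-cong (*-congʳ t≈) (*-congˡ u≈)) ⟨
    ⟦ t ⟧ * ⟦ u ⟧ + ((⟦ t ⟧ + ⌜ n ⌝) * ⌜ n′ ⌝ + ⌜ n ⌝ * (⟦ u ⟧ + ⌜ n′ ⌝))
                                       ≈⟨ product-of-differences ⟦ t ⟧ ⟦ u ⟧ ⌜ n ⌝ ⌜ n′ ⌝ ⟩
    (⟦ t ⟧ + ⌜ n ⌝) * (⟦ u ⟧ + ⌜ n′ ⌝) + ⌜ n ⌝ * ⌜ n′ ⌝       ≈⟨ +-cong (*-cong t≈ u≈) (sym (⌜*⌝ n n′)) ⟩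
    ⌜ p ⌝ * ⌜ p′ ⌝ + ⌜ n ℕ.* n′ ⌝                             ≈⟨ +-congʳ (⌜*⌝ p p′) ⟨
    ⌜ p ℕ.* p′ ⌝ + ⌜ n ℕ.* n′ ⌝                               ≈⟨ ⌜+⌝ (p ℕ.* p′) (n ℕ.* n′) ⟨
    ⌜ p ℕ.* p′ ℕ.+ n ℕ.* n′ ⌝                                 ∎
  ⟦⟧-difference (-ₑ t) with difference t | ⟦⟧-difference t
  ... | p , n | t≈ = begin
    - ⟦ t ⟧ + ⌜ p ⌝             ≈⟨ +-congˡ t≈ ⟨
    - ⟦ t ⟧ + (⟦ t ⟧ + ⌜ n ⌝)   ≈⟨ +-assoc (- ⟦ t ⟧) ⟦ t ⟧ ⌜ n ⌝ ⟨
    - ⟦ t ⟧ + ⟦ t ⟧ + ⌜ n ⌝     ≈⟨ +-congʳ (-‿inverseˡ ⟦ t ⟧) ⟩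
    0# + ⌜ n ⌝                  ≈⟨ +-identityˡ ⌜ n ⌝ ⟩
    ⌜ n ⌝                       ∎

∑₈ₑ : (Fin 8 → Expr) → Expr
∑₈ₑ f = f (# 0) +ₑ (f (# 1) +ₑ (f (# 2) +ₑ (f (# 3) +ₑ (f (# 4) +ₑ (f (# 5) +ₑ (f (# 6) +ₑ f (# 7)))))))

-- A verbatim copy of Octonions._⋆_ on expressions, so that ⟦ (x ⋆ₑ y) k ⟧ reduces to (⟦ x ⟧ ⋆ ⟦ y ⟧) k.
infixl 7 _⋆ₑ_
_⋆ₑ_ : (Fin 8 → Expr) → (Fin 8 → Expr) → Fin 8 → Expr
(x ⋆ₑ y) k = ∑₈ₑ λ a → ∑₈ₑ λ b →
  if does (octIndex a b ≟ k)
  then (if octSign a b then x a *ₑ y b else -ₑ (x a *ₑ y b))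
  else 0ₑ

e₁+e₆ e₃+e₄ e₄ : Fin 8 → Expr
e₁+e₆ = lookup (0ₑ ∷ 1ₑ ∷ 0ₑ ∷ 0ₑ ∷ 0ₑ ∷ 0ₑ ∷ 1ₑ ∷ 0ₑ ∷ [])
e₃+e₄ = lookup (0ₑ ∷ 0ₑ ∷ 0ₑ ∷ 1ₑ ∷ 1ₑ ∷ 0ₑ ∷ 0ₑ ∷ 0ₑ ∷ [])
e₄    = lookup (0ₑ ∷ 0ₑ ∷ 0ₑ ∷ 0ₑ ∷ 1ₑ ∷ 0ₑ ∷ 0ₑ ∷ 0ₑ ∷ [])

module OctonionSubspaces {c ℓ₁ ℓ₂ : Level} (ℝ : RealNumbers c ℓ₁ ℓ₂) where
  open RealNumbers ℝ
  open Octonions ℝ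
  open RingProperties ring using (-‿distribˡ-*; -‿distribʳ-*; -‿involutive; +-identityˡ-unique)
  open import Algebra.Properties.CommutativeSemigroup *-commutativeSemigroup using (interchange)
  open CommutativeRingIdentities commutativeRing using (*-distribˡ-+₈)
  open Evaluation commutativeRing using (⟦_⟧; ⌜_⌝; ⟦⟧-difference)
  open IsTotalOrder isTotalOrder using (total; antisym; ≲-respˡ-≈; ≲-respʳ-≈)
  open import Relation.Binary.Reasoning.Setoid setoid

  0≤1 : 0# ≤ 1#
  0≤1 with total 0# 1#
  ... | inj₁ 0≤1 = 0≤1
  ... | inj₂ 1≤0 = ≲-respʳ-≈ -1*-1≈1 (*-nonneg 0≤-1 0≤-1)
    where
    0≤-1 : 0# ≤ (- 1#)
    0≤-1 = ≲-respʳ-≈ (+-identityˡ (- 1#)) (≲-respˡ-≈ (-‿inverseʳ 1#) (+-mono-≤ (- 1#) 1≤0))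
    -1*-1≈1 : - 1# * - 1# ≈ 1#
    -1*-1≈1 = trans (sym (-‿distribˡ-* 1# (- 1#))) (trans (-‿cong (*-identityˡ (- 1#))) (-‿involutive 1#))

  2≉0 : ¬ ⌜ 2 ⌝ ≈ 0#
  2≉0 2≈0 = 0≉1 (antisym 0≤1 1≤0)
    where
    1≤0 : 1# ≤ 0#
    1≤0 = ≲-respˡ-≈ (trans (+-identityˡ _) (+-identityʳ 1#)) (≲-respʳ-≈ 2≈0 (+-mono-≤ ⌜ 1 ⌝ 0≤1))

  summand : Bool → Bool → Carrier → Carrier
  summand i s v = if i then (if s then v else - v) else 0#

  summand-cong : ∀ i s {v w} → v ≈ w → summand i s v ≈ summand i s w
  summand-cong true  true  v≈w = v≈w
  summand-cong true  false v≈w = -‿cong v≈w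
  summand-cong false s     v≈w = refl

  summand-* : ∀ i s r v → summand i s (r * v) ≈ r * summand i s v
  summand-* true  true  r v = refl
  summand-* true  false r v = -‿distribʳ-* r v
  summand-* false s     r v = sym (zeroʳ r)

  ∑₈-cong : ∀ {f g} → (∀ a → f a ≈ g a) → ∑₈ f ≈ ∑₈ g
  ∑₈-cong f≈g = +-cong (f≈g _) (+-cong (f≈g _) (+-cong (f≈g _) (+-cong (f≈g _)
                (+-cong (f≈g _) (+-cong (f≈g _) (+-cong (f≈g _) (f≈g _)))))))

  ∑₈-* : ∀ r f → ∑₈ (λ a → r * f a) ≈ r * ∑₈ f
  ∑₈-* r f = *-distribˡ-+₈ r (f _) (f _) (f _) (f _) (f _) (f _) (f _) (f _)

  ⋆-• : ∀ {r s u w a b} → u ≈ᵒ r • a → w ≈ᵒ s • b → u ⋆ w ≈ᵒ (r * s) • (a ⋆ b)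
  ⋆-• {r} {s} {u} {w} {a} {b} u≈ra w≈sb k = begin
    (u ⋆ w) k                                          ≈⟨ ∑₈-cong (λ i → ∑₈-cong (term-• i)) ⟩
    ∑₈ (λ i → ∑₈ (λ j → r * s * term a b i j))          ≈⟨ ∑₈-cong (λ i → ∑₈-* (r * s) (term a b i)) ⟩
    ∑₈ (λ i → r * s * ∑₈ (term a b i))                  ≈⟨ ∑₈-* (r * s) (λ i → ∑₈ (term a b i)) ⟩
    r * s * (a ⋆ b) k                                  ∎
    where
    hit : Fin 8 → Fin 8 → Bool
    hit i j = does (octIndex i j ≟ k)

    term : 𝕆 → 𝕆 → Fin 8 → Fin 8 → Carrier
    term x y i j = summand (hit i j) (octSign i j) (x i * y j)

    term-• : ∀ i j → term u w i j ≈ r * s * term a b i j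
    term-• i j = trans
      (summand-cong (hit i j) (octSign i j) (trans (*-cong (u≈ra i) (w≈sb j)) (interchange r (a i) s (b j))))
      (summand-* (hit i j) (octSign i j) (r * s) (a i * b j))

  Line : 𝕆 → Pred 𝕆 (c ⊔ ℓ₁)
  Line v x = ∃[ r ] x ≈ᵒ r • v

  line : 𝕆 → Subspace
  line v = record
    { _∈S      = Line v
    ; resp     = λ { x≈y (r , x≈rv) → r , λ i → trans (sym (x≈y i)) (x≈rv i) }
    ; 0∈       = 0# , λ i → sym (zeroˡ (v i))
    ; +-closed = λ { (r , x≈rv) (s , y≈sv) → r + s , λ i → trans (+-cong (x≈rv i) (y≈sv i)) (sym (distribʳ (v i) r s)) }
    ; •-closed = λ { t (r , x≈rv) → t * r , λ i → trans (*-congˡ (x≈rv i)) (sym (*-assoc t r (v i))) }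
    }

  Line-self : ∀ v → Line v v
  Line-self v = 1# , λ i → sym (*-identityˡ (v i))

  Span-least : ∀ {S} (V : Subspace) → S ⊆′ _∈S V → Span S ⊆′ _∈S V
  Span-least {S} V S⊆V x (xs , xs∈S , x≈xs) = resp V (λ i → sym (x≈xs i)) (lincomb-∈ xs xs∈S)
    where
    lincomb-∈ : ∀ xs → All (λ rv → S (proj₂ rv)) xs → _∈S V (lincomb xs)
    lincomb-∈ []             []            = 0∈ V
    lincomb-∈ ((r , v) ∷ xs) (v∈S ∷ xs∈S) = +-closed V (•-closed V r (S⊆V v v∈S)) (lincomb-∈ xs xs∈S)

  ∈-Span : ∀ {S x} → S x → Span S x
  ∈-Span {x = x} x∈S = (1# , x) ∷ [] , x∈S ∷ [] , λ i → sym (trans (+-identityʳ _) (*-identityˡ (x i)))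

  ⋆-∈-Products : ∀ {U W u w} → U u → W w → Products U W (u ⋆ w)
  ⋆-∈-Products {u = u} {w} u∈U w∈W = u , w , u∈U , w∈W , λ i → refl

  Products-monoʳ : ∀ {U W W′} → W ⊆′ W′ → Products U W ⊆′ Products U W′
  Products-monoʳ W⊆W′ x (u , w , u∈U , w∈W , x≈uw) = u , w , u∈U , W⊆W′ w w∈W , x≈uw

  Products-Line : ∀ {a b} → Products (Line a) (Line b) ⊆′ Line (a ⋆ b)
  Products-Line x (u , w , (r , u≈ra) , (s , w≈sb) , x≈uw) = r * s , λ i → trans (x≈uw i) (⋆-• u≈ra w≈sb i)

  lines-not-associative : ∀ u v w → ¬ Line (u ⋆ (v ⋆ w)) ((u ⋆ v) ⋆ w) →
    ¬ (((Line u ⊗ Line v) ⊗ Line w) ≐ (Line u ⊗ (Line v ⊗ Line w)))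
  lines-not-associative u v w ∉Line ⊗-assoc = ∉Line (right-⊆-Line _ (proj₁ (⊗-assoc _) left-∋))
    where
    left-∋ : ((Line u ⊗ Line v) ⊗ Line w) ((u ⋆ v) ⋆ w)
    left-∋ = ∈-Span (⋆-∈-Products (∈-Span (⋆-∈-Products (Line-self u) (Line-self v))) (Line-self w))

    right-⊆-Line : (Line u ⊗ (Line v ⊗ Line w)) ⊆′ Line (u ⋆ (v ⋆ w))
    right-⊆-Line = Span-least (line _) λ t →
      Products-Line t ∘ Products-monoʳ (Span-least (line _) Products-Line) t

  ⟦_⟧ᵛ : (Fin 8 → Expr) → 𝕆
  ⟦ x ⟧ᵛ i = ⟦ x i ⟧

  x y z : 𝕆
  x = ⟦ e₁+e₆ ⟧ᵛ
  y = ⟦ e₃+e₄ ⟧ᵛ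
  z = ⟦ e₄ ⟧ᵛ

  [xy]z-at-e₆ : ((x ⋆ y) ⋆ z) (# 6) + ⌜ 2 ⌝ ≈ 0#
  [xy]z-at-e₆ = ⟦⟧-difference (((e₁+e₆ ⋆ₑ e₃+e₄) ⋆ₑ e₄) (# 6))

  x[yz]-at-e₆ : (x ⋆ (y ⋆ z)) (# 6) ≈ 0#
  x[yz]-at-e₆ = +-identityˡ-unique _ _ (⟦⟧-difference ((e₁+e₆ ⋆ₑ (e₃+e₄ ⋆ₑ e₄)) (# 6)))

  [xy]z-∉-Line-x[yz] : ¬ Line (x ⋆ (y ⋆ z)) ((x ⋆ y) ⋆ z)
  [xy]z-∉-Line-x[yz] (r , [xy]z≈r•x[yz]) = 2≉0 (begin
    ⌜ 2 ⌝                          ≈⟨ +-identityˡ ⌜ 2 ⌝ ⟨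
    0# + ⌜ 2 ⌝                     ≈⟨ +-congʳ [xy]z-at-e₆≈0 ⟨
    ((x ⋆ y) ⋆ z) (# 6) + ⌜ 2 ⌝    ≈⟨ [xy]z-at-e₆ ⟩
    0#                             ∎)
    where
    [xy]z-at-e₆≈0 : ((x ⋆ y) ⋆ z) (# 6) ≈ 0#
    [xy]z-at-e₆≈0 = trans ([xy]z≈r•x[yz] (# 6)) (trans (*-congˡ x[yz]-at-e₆) (zeroʳ r))

mainTheorem8 : {c ℓ₁ ℓ₂ : Level} (ℝ : RealNumbers c ℓ₁ ℓ₂) →
    let open Octonions ℝ in
    ∃[ U ] ∃[ W ] ∃[ Z ]
    (¬ (((_∈S U ⊗ _∈S W) ⊗ _∈S Z) ≐ (_∈S U ⊗ (_∈S W ⊗ _∈S Z))))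
mainTheorem8 ℝ = line x , line y , line z , lines-not-associative x y z [xy]z-∉-Line-x[yz]
  where open OctonionSubspaces ℝ
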